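{- Let $n\ge4$ and $k\ge1$ be integers. Then \[ \gamma_{[k]R}(C_8\Box P_n)\le 8(n-2)\left\lceil\frac{k+5}{5}\right\rceil+16\left\lceil\frac{k+3-\left\lceil\frac{k+5}{5}\right\rceil}{3}\right\rceil-2\left(n-\left\lfloor\frac n3\right\rfloor\right). \]
   Context: For a graph $G$ and $v\in V(G)$, $N(v)$ is the open neighborhood and $N[v]=N(v)\cup\{v\}$. For an integer $k\ge1$, a function $f:V(G)\to\{0,1,\dots,k+1\}$ is a $[k]$-Roman dominating function if for every vertex $v$ with $f(v)<k$ we have $\sum_{u\in N[v]}f(u)\ge k+|\{u\in N(v): f(u)>0\}|$. The weight of $f$ is $\sum_{v}f(v)$, and $\gamma_{[k]R}(G)$ is the minimum weight of a $[k]$-Roman dominating function on $G$. $C_m\Box P_n$ is the Cartesian product of the cycle $C_m$ (vertices $0,\dots,m-1$ mod $m$) and the path $P_n$ (vertices $0,\dots,n-1$): $(i,j)\sim(i',j')$ iff ($i=i'$ and $|j-j'|=1$) or ($j=j'$ and $i'\equiv i\pm1 \pmod m$). -}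

module Defs where

open import Data.Nat using (ℕ; zero; suc; _+_; _*_; _∸_; _≤_; _<_; _≡ᵇ_; _<ᵇ_)
open import Data.Nat.DivMod using (_/_; _%_)
open import Data.Bool using (Bool; _∧_; _∨_)
open import Data.Fin using (Fin; toℕ)
open import Data.Product using (_×_; _,_; Σ-syntax)
open import Data.List using (List; filterᵇ; map; length; allFin; cartesianProduct)
open import Data.Nat.ListAction using (sum)

-- Vertices of C_m □ P_n : pairs (i , j) with i ∈ Fin m (cycle) and j ∈ Fin n (path).
Vertex : ℕ → ℕ → Set
Vertex m n = Fin m × Fin n

vertices : (m n : ℕ) → List (Vertex m n)
vertices m n = cartesianProduct (allFin m) (allFin n)

adj : (m n : ℕ) → Vertex m n → Vertex m n → Bool
adj zero    n (() , _) _
adj (suc m) n (i , j) (i' , j') =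
  ((toℕ i ≡ᵇ toℕ i') ∧ ((suc (toℕ j) ≡ᵇ toℕ j') ∨ (suc (toℕ j') ≡ᵇ toℕ j)))
  ∨ ((toℕ j ≡ᵇ toℕ j') ∧ ((suc (toℕ i) % suc m ≡ᵇ toℕ i') ∨ (suc (toℕ i') % suc m ≡ᵇ toℕ i)))

N : (m n : ℕ) → Vertex m n → List (Vertex m n)
N m n v = filterᵇ (adj m n v) (vertices m n)

weight : (m n : ℕ) → (Vertex m n → ℕ) → ℕ
weight m n f = sum (map f (vertices m n))

record IsKRDF (k m n : ℕ) (f : Vertex m n → ℕ) : Set where
  field
    range : ∀ v → f v ≤ suc k
    cond  : ∀ v → f v < k →
            k + length (filterᵇ (λ u → 0 <ᵇ f u) (N m n v))
              ≤ f v + sum (map f (N m n v))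

-- γ_{[k]R}(C_m □ P_n) ≤ b : there is a [k]-RDF of weight at most b
-- (γ is the minimum weight, so this is exactly the meaning of the inequality).
γ[_]R-CP≤ : ℕ → ℕ → ℕ → ℕ → Set
γ[ k ]R-CP≤ m n b = Σ[ f ∈ (Vertex m n → ℕ) ] (IsKRDF k m n f × weight m n f ≤ b)

⌈_/suc_⌉ : ℕ → ℕ → ℕ
⌈ a /suc b ⌉ = (a + b) / suc b

{-# OPTIONS --safe #-}
module Submission where

-- Each dominating function is described column by column (a column being a copy of C₈),
-- with values that are linear forms in k and in x = q − s, y = B − 1, where q = ⌈(k+5)/5⌉
-- and B = ⌈(k+3−q)/3⌉.  As |{u ∈ N(v) : f u > 0}| + Σ_{u ∈ N(v)} (f u ∸ 1) = Σ_{u ∈ N(v)} f u,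
-- the condition at v follows from k ≤ f v + Σ_{u ∈ N(v)} (f u ∸ 1), which for each of the
-- finitely many shapes of three consecutive columns is an inequality between linear forms,
-- decided by comparing coefficients with basic facts such as k ≤ 5q − 5 and k ≤ q + 3B − 3.
-- The general design puts B (and some B + 1) on the two end columns, mostly q − 1 next to
-- them, and q elsewhere except for q − 1 in every fourth row of two out of every three
-- interior columns; its weight meets the bound exactly for n ≥ 5.  It needs k ≤ 4q + B − 6,
-- which fails only for k = 5; there the value 6 on a staggered quarter of the vertices works.
-- For n ∈ {4, 5} and small k the candidate functions are checked by evaluation.

open import Defs
open import Data.Bool using (Bool; true; false; T; not; _∧_; _∨_; if_then_else_)
open import Data.Bool.Properties using (T-∧; T-∨; ∧-identityʳ)
open import Data.Bool.ListAction using (all; any)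
open import Data.Empty using (⊥-elim)
open import Data.Unit using (tt)
open import Data.Fin using (Fin; toℕ)
open import Data.Fin.Properties using (toℕ<n)
open import Data.List using (List; []; _∷_; _++_; map; foldr; filterᵇ; length; tabulate; allFin; upTo; applyUpTo; cartesianProduct)
open import Data.List.Properties using (map-++; map-∘; map-cong; map-tabulate)
open import Data.List.Membership.Propositional using (find)
open import Data.List.Membership.Propositional.Properties using (∈-allFin; ∈-upTo⁺; ∈-applyUpTo⁺)
open import Data.List.Relation.Unary.All as All using (All)
open import Data.List.Relation.Unary.All.Properties using (all⁺)
open import Data.List.Relation.Unary.Any.Properties using (any⁻)
open import Data.Maybe using (Maybe; just; nothing)
open import Data.Vec as Vec using (Vec; []; _∷_)
open import Data.Nat using (ℕ; zero; suc; _+_; _*_; _∸_; _≤_; _<_; _≤ᵇ_; _<ᵇ_; _≡ᵇ_; z≤n; s≤s; z<s; s<s; _≤?_; _≟_)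
open import Data.Nat.ListAction using (sum)
open import Data.Nat.ListAction.Properties using (sum-++)
open import Data.Nat.Properties
open import Data.Nat.DivMod using (_/_; _%_; m≡m%n+[m/n]*n; m%n<n; m/n*n≤m; m/n≤m; +-distrib-/-∣ˡ)
open import Data.Nat.Divisibility using (∣-refl)
open import Algebra.Properties.CommutativeSemigroup +-commutativeSemigroup using (interchange; x∙yz≈y∙xz)
open import Data.Nat.Tactic.RingSolver using (solve-∀)
open import Data.Product using (_×_; _,_; proj₁; proj₂)
open import Data.Sum using (inj₁; inj₂)
open import Function using (id; _∘_; Equivalence)
open import Relation.Binary.PropositionalEquality
open import Relation.Nullary using (¬_; yes; no)

∑< : ℕ → (ℕ → ℕ) → ℕ
∑< zero    Q = 0
∑< (suc n) Q = Q 0 + ∑< n (Q ∘ suc)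

syntax ∑< n (λ m → e) = ∑[ m < n ] e

sum-tabulate≡∑< : ∀ n (Q : ℕ → ℕ) → sum (tabulate {n = n} (Q ∘ toℕ)) ≡ ∑< n Q
sum-tabulate≡∑< zero    Q = refl
sum-tabulate≡∑< (suc n) Q = cong (Q 0 +_) (sum-tabulate≡∑< n (Q ∘ suc))

sum-allFin≡∑< : ∀ n (Q : ℕ → ℕ) → sum (map (Q ∘ toℕ) (allFin n)) ≡ ∑< n Q
sum-allFin≡∑< n Q = trans (cong sum (map-tabulate {n = n} id (Q ∘ toℕ))) (sum-tabulate≡∑< n Q)

∑<-cong : ∀ n {Q Q′ : ℕ → ℕ} → (∀ m → m < n → Q m ≡ Q′ m) → ∑< n Q ≡ ∑< n Q′
∑<-cong zero    eq = refl
∑<-cong (suc n) eq = cong₂ _+_ (eq 0 z<s) (∑<-cong n (λ m m<n → eq (suc m) (s<s m<n)))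

∑<-mono : ∀ n {Q Q′ : ℕ → ℕ} → (∀ m → Q m ≤ Q′ m) → ∑< n Q ≤ ∑< n Q′
∑<-mono zero    le = z≤n
∑<-mono (suc n) le = +-mono-≤ (le 0) (∑<-mono n (le ∘ suc))

∑<-const : ∀ n c → ∑[ m < n ] c ≡ n * c
∑<-const zero    c = refl
∑<-const (suc n) c = cong (c +_) (∑<-const n c)

∑<-zero : ∀ n → ∑[ m < n ] 0 ≡ 0
∑<-zero n = trans (∑<-const n 0) (*-zeroʳ n)

∑<-distrib-+ : ∀ n (Q Q′ : ℕ → ℕ) → ∑[ m < n ] (Q m + Q′ m) ≡ ∑< n Q + ∑< n Q′
∑<-distrib-+ zero    Q Q′ = refl
∑<-distrib-+ (suc n) Q Q′ = trans (cong (Q 0 + Q′ 0 +_) (∑<-distrib-+ n (Q ∘ suc) (Q′ ∘ suc)))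
                                  (interchange (Q 0) (Q′ 0) _ _)

∑<-snoc : ∀ n (Q : ℕ → ℕ) → ∑< (suc n) Q ≡ ∑< n Q + Q n
∑<-snoc zero    Q = +-identityʳ (Q 0)
∑<-snoc (suc n) Q = trans (cong (Q 0 +_) (∑<-snoc n (Q ∘ suc))) (sym (+-assoc (Q 0) _ _))

∑<-indicator : ∀ n t (G : ℕ → ℕ) → ∑[ m < n ] (if t ≡ᵇ m then G m else 0) ≡ (if t <ᵇ n then G t else 0)
∑<-indicator zero    t       G = refl
∑<-indicator (suc n) zero    G = trans (cong (G 0 +_) (∑<-zero n)) (+-identityʳ (G 0))
∑<-indicator (suc n) (suc t) G = ∑<-indicator n t (G ∘ suc)

sum-∑<-comm : ∀ {A : Set} n (Q : A → ℕ → ℕ) (xs : List A) →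
  sum (map (λ a → ∑< n (Q a)) xs) ≡ ∑[ m < n ] sum (map (λ a → Q a m) xs)
sum-∑<-comm n Q []       = sym (∑<-zero n)
sum-∑<-comm n Q (a ∷ xs) = trans (cong (∑< n (Q a) +_) (sum-∑<-comm n Q xs))
                                 (sym (∑<-distrib-+ n (Q a) (λ m → sum (map (λ a → Q a m) xs))))

sum-map-mono : ∀ {A : Set} {f g : A → ℕ} (xs : List A) → (∀ a → f a ≤ g a) → sum (map f xs) ≤ sum (map g xs)
sum-map-mono []       le = z≤n
sum-map-mono (a ∷ xs) le = +-mono-≤ (le a) (sum-map-mono xs le)

sum-map-filterᵇ : ∀ {A : Set} (p : A → Bool) (h : A → ℕ) xs →
  sum (map h (filterᵇ p xs)) ≡ sum (map (λ a → if p a then h a else 0) xs)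
sum-map-filterᵇ p h []       = refl
sum-map-filterᵇ p h (a ∷ xs) with p a
... | true  = cong (h a +_) (sum-map-filterᵇ p h xs)
... | false = sum-map-filterᵇ p h xs

sum-map-cartesianProduct : ∀ {A B : Set} (h : A × B → ℕ) xs ys →
  sum (map h (cartesianProduct xs ys)) ≡ sum (map (λ a → sum (map (λ b → h (a , b)) ys)) xs)
sum-map-cartesianProduct h []       ys = refl
sum-map-cartesianProduct h (a ∷ xs) ys = begin
  sum (map h (map (a ,_) ys ++ cartesianProduct xs ys))
    ≡⟨ cong sum (map-++ h (map (a ,_) ys) (cartesianProduct xs ys)) ⟩
  sum (map h (map (a ,_) ys) ++ map h (cartesianProduct xs ys))
    ≡⟨ sum-++ (map h (map (a ,_) ys)) (map h (cartesianProduct xs ys)) ⟩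
  sum (map h (map (a ,_) ys)) + sum (map h (cartesianProduct xs ys))
    ≡⟨ cong₂ _+_ (cong sum (sym (map-∘ ys))) (sum-map-cartesianProduct h xs ys) ⟩
  sum (map (λ b → h (a , b)) ys) + sum (map (λ a → sum (map (λ b → h (a , b)) ys)) xs) ∎
  where open ≡-Reasoning

count-positive+sum-pred≡sum : ∀ {A : Set} (f : A → ℕ) xs →
  length (filterᵇ (λ a → 0 <ᵇ f a) xs) + sum (map (λ a → f a ∸ 1) xs) ≡ sum (map f xs)
count-positive+sum-pred≡sum f []       = refl
count-positive+sum-pred≡sum f (a ∷ xs) with f a
... | zero  = count-positive+sum-pred≡sum f xs
... | suc v = cong suc (trans (x∙yz≈y∙xz (length (filterᵇ (λ a → 0 <ᵇ f a) xs)) v _)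
                              (cong (v +_) (count-positive+sum-pred≡sum f xs)))

-- Linear forms

record Lin : Set where
  constructor lin
  field
    cx cy ck c₀ : ℕ

infixl 6 _⊕_
_⊕_ : Lin → Lin → Lin
lin a b c d ⊕ lin a′ b′ c′ d′ = lin (a + a′) (b + b′) (c + c′) (d + d′)

0ₗ : Lin
0ₗ = lin 0 0 0 0

∑ₗ : List Lin → Lin
∑ₗ = foldr _⊕_ 0ₗ

-- Only the constant term can be lowered symbolically, so a form with constant 0 is sent to 0ₗ.
predₗ : Lin → Lin
predₗ (lin a b c zero)    = 0ₗ
predₗ (lin a b c (suc d)) = lin a b c d

_≤ᶜ_ : Lin → Lin → Bool
lin a b c d ≤ᶜ lin a′ b′ c′ d′ = (a ≤ᵇ a′) ∧ (b ≤ᵇ b′) ∧ (c ≤ᵇ c′) ∧ (d ≤ᵇ d′)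

module Evaluation (x y k : ℕ) where

  ⟦_⟧ : Lin → ℕ
  ⟦ lin a b c d ⟧ = a * x + b * y + c * k + d

  ⟦⊕⟧ : ∀ A B → ⟦ A ⊕ B ⟧ ≡ ⟦ A ⟧ + ⟦ B ⟧
  ⟦⊕⟧ (lin a b c d) (lin a′ b′ c′ d′) = distrib a b c d a′ b′ c′ d′ x y k
    where
    distrib : ∀ a b c d a′ b′ c′ d′ x y k →
      (a + a′) * x + (b + b′) * y + (c + c′) * k + (d + d′)
        ≡ (a * x + b * y + c * k + d) + (a′ * x + b′ * y + c′ * k + d′)
    distrib = solve-∀

  ⟦∑ₗ⟧ : ∀ Ls → ⟦ ∑ₗ Ls ⟧ ≡ sum (map ⟦_⟧ Ls)
  ⟦∑ₗ⟧ []       = refl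
  ⟦∑ₗ⟧ (L ∷ Ls) = trans (⟦⊕⟧ L (∑ₗ Ls)) (cong (⟦ L ⟧ +_) (⟦∑ₗ⟧ Ls))

  ∑<-⟦⟧ : ∀ n (L : ℕ → Lin) → ∑[ t < n ] ⟦ L t ⟧ ≡ ⟦ ∑ₗ (applyUpTo L n) ⟧
  ∑<-⟦⟧ zero    L = refl
  ∑<-⟦⟧ (suc n) L = trans (cong (⟦ L 0 ⟧ +_) (∑<-⟦⟧ n (L ∘ suc))) (sym (⟦⊕⟧ (L 0) (∑ₗ (applyUpTo (L ∘ suc) n))))

  ⟦predₗ⟧ : ∀ L → ⟦ predₗ L ⟧ ≤ ⟦ L ⟧ ∸ 1
  ⟦predₗ⟧ (lin a b c zero)    = z≤n
  ⟦predₗ⟧ (lin a b c (suc d)) = ≤-reflexive (sym (cong (_∸ 1) (+-suc (a * x + b * y + c * k) d)))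

  ⟦⟧-+const : ∀ a b c d e → ⟦ lin a b c (d + e) ⟧ ≡ ⟦ lin a b c d ⟧ + e
  ⟦⟧-+const a b c d e = sym (+-assoc (a * x + b * y + c * k) d e)

  lower-shift : ∀ a b c d e → k + e ≤ ⟦ lin a b c (d + e) ⟧ → k ≤ ⟦ lin a b c d ⟧
  lower-shift a b c d e le = +-cancelʳ-≤ e k ⟦ lin a b c d ⟧ (≤-trans le (≤-reflexive (⟦⟧-+const a b c d e)))

  ⟦⟧-mono : ∀ A B → T (A ≤ᶜ B) → ⟦ A ⟧ ≤ ⟦ B ⟧
  ⟦⟧-mono (lin a b c d) (lin a′ b′ c′ d′) A≤B
    with a≤a′ , B≤ ← Equivalence.to (T-∧ {a ≤ᵇ a′}) A≤B
    with b≤b′ , C≤ ← Equivalence.to (T-∧ {b ≤ᵇ b′}) B≤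
    with c≤c′ , d≤d′ ← Equivalence.to (T-∧ {c ≤ᵇ c′}) C≤
    = +-mono-≤ (+-mono-≤ (+-mono-≤ (*-monoˡ-≤ x (≤ᵇ⇒≤ a a′ a≤a′)) (*-monoˡ-≤ y (≤ᵇ⇒≤ b b′ b≤b′)))
                         (*-monoˡ-≤ k (≤ᵇ⇒≤ c c′ c≤c′)))
               (≤ᵇ⇒≤ d d′ d≤d′)

before : {A : Set} → A → (ℕ → A) → ℕ → A
before z F zero    = z
before z F (suc t) = F t

after : {A : Set} → A → ℕ → (ℕ → A) → ℕ → A
after z n F t = if suc t <ᵇ n then F (suc t) else z

before-map : ∀ {A B : Set} (f : A → B) z F t → f (before z F t) ≡ before (f z) (f ∘ F) t
before-map f z F zero    = refl
before-map f z F (suc t) = refl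

after-map : ∀ {A B : Set} (f : A → B) z n F t → f (after z n F t) ≡ after (f z) n (f ∘ F) t
after-map f z n F t with suc t <ᵇ n
... | true  = refl
... | false = refl

select : {A : Set} → Bool → Bool → A → A → A → A
select true  r₂    a b z = a
select false true  a b z = b
select false false a b z = z

sameRow : ∀ {c} → Fin c → Fin c → Bool
sameRow i i′ = toℕ i ≡ᵇ toℕ i′

cycleAdj : ∀ m → Fin (suc m) → Fin (suc m) → Bool
cycleAdj m i i′ = (suc (toℕ i) % suc m ≡ᵇ toℕ i′) ∨ (suc (toℕ i′) % suc m ≡ᵇ toℕ i)

pathAdj : ℕ → ℕ → Bool
pathAdj t s = (suc t ≡ᵇ s) ∨ (suc s ≡ᵇ t)

if-∨-disjoint : ∀ a b (g : ℕ) → (T a → ¬ T b) →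
  (if a ∨ b then g else 0) ≡ (if a then g else 0) + (if b then g else 0)
if-∨-disjoint true  true  g a⇒¬b = ⊥-elim (a⇒¬b _ _)
if-∨-disjoint true  false g a⇒¬b = sym (+-identityʳ g)
if-∨-disjoint false b     g a⇒¬b = refl

if-∨-≥ : ∀ a b (g : ℕ) → (if a then g else 0) ≤ (if a ∨ b then g else 0)
if-∨-≥ true  b g = ≤-refl
if-∨-≥ false b g = z≤n

∑<-before : ∀ n t (G : ℕ → ℕ) → t ≤ n → ∑[ s < n ] (if suc s ≡ᵇ t then G s else 0) ≡ before 0 G t
∑<-before n       zero                G t≤n       = ∑<-zero n
∑<-before (suc n) (suc zero)          G t≤n       = trans (cong (G 0 +_) (∑<-zero n)) (+-identityʳ (G 0))
∑<-before (suc n) (suc (suc t))       G (s≤s t≤n) = ∑<-before n (suc t) (G ∘ suc) t≤n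

∑<-pathAdj : ∀ n t (G : ℕ → ℕ) → t < n →
  ∑[ s < n ] (if pathAdj t s then G s else 0) ≡ after 0 n G t + before 0 G t
∑<-pathAdj n t G t<n = begin
  ∑[ s < n ] (if pathAdj t s then G s else 0)
    ≡⟨ ∑<-cong n (λ s _ → if-∨-disjoint (suc t ≡ᵇ s) (suc s ≡ᵇ t) (G s) (not-both s)) ⟩
  ∑[ s < n ] ((if suc t ≡ᵇ s then G s else 0) + (if suc s ≡ᵇ t then G s else 0))
    ≡⟨ ∑<-distrib-+ n _ _ ⟩
  ∑[ s < n ] (if suc t ≡ᵇ s then G s else 0) + ∑[ s < n ] (if suc s ≡ᵇ t then G s else 0)
    ≡⟨ cong₂ _+_ (∑<-indicator n (suc t) G) (∑<-before n t G (<⇒≤ t<n)) ⟩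
  after 0 n G t + before 0 G t ∎
  where
  open ≡-Reasoning
  not-both : ∀ s → T (suc t ≡ᵇ s) → ¬ T (suc s ≡ᵇ t)
  not-both s ts st with refl ← ≡ᵇ⇒≡ (suc t) s ts = m≢1+n+m t {1} (sym (≡ᵇ⇒≡ (suc s) t st))

if-T : ∀ {b} (g : ℕ) → T b → (if b then g else 0) ≡ g
if-T {true} g _ = refl

select≤∑<-row : ∀ n t (G : ℕ → ℕ) r₁ r₂ → t < n →
  select r₁ r₂ (after 0 n G t + before 0 G t) (G t) 0
    ≤ ∑[ s < n ] (if (r₁ ∧ pathAdj t s) ∨ ((t ≡ᵇ s) ∧ r₂) then G s else 0)
select≤∑<-row n t G true r₂ t<n = begin
  after 0 n G t + before 0 G t                          ≡⟨ ∑<-pathAdj n t G t<n ⟨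
  ∑[ s < n ] (if pathAdj t s then G s else 0)           ≤⟨ ∑<-mono n (λ s → if-∨-≥ (pathAdj t s) _ (G s)) ⟩
  ∑[ s < n ] (if pathAdj t s ∨ ((t ≡ᵇ s) ∧ r₂) then G s else 0) ∎
  where open ≤-Reasoning
select≤∑<-row n t G false true t<n = ≤-reflexive (begin
  G t                                                   ≡⟨ if-T (G t) (<⇒<ᵇ t<n) ⟨
  (if t <ᵇ n then G t else 0)                           ≡⟨ ∑<-indicator n t G ⟨
  ∑[ s < n ] (if t ≡ᵇ s then G s else 0)                ≡⟨ ∑<-cong n (λ s _ → cong (λ b → if b then G s else 0) (∧-identityʳ (t ≡ᵇ s))) ⟨
  ∑[ s < n ] (if (t ≡ᵇ s) ∧ true then G s else 0)       ∎)
  where open ≡-Reasoning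
select≤∑<-row n t G false false t<n = z≤n

module _ (m n : ℕ) (G : Fin (suc m) → ℕ → ℕ) where

  rowwiseBound : Fin (suc m) → ℕ → ℕ
  rowwiseBound i t = sum (map (λ i′ → select (sameRow i i′) (cycleAdj m i i′)
                                        (after 0 n (G i′) t + before 0 (G i′) t) (G i′ t) 0)
                              (allFin (suc m)))

  rowwiseBound≤sum-N : ∀ i (j : Fin n) →
    rowwiseBound i (toℕ j) ≤ sum (map (λ u → G (proj₁ u) (toℕ (proj₂ u))) (N (suc m) n (i , j)))
  rowwiseBound≤sum-N i j = begin
    rowwiseBound i t
      ≤⟨ sum-map-mono (allFin (suc m)) (λ i′ → select≤∑<-row n t (G i′) (sameRow i i′) (cycleAdj m i i′) (toℕ<n j)) ⟩
    sum (map (λ i′ → ∑[ s < n ] indicator i′ s) (allFin (suc m)))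
      ≡⟨ cong sum (map-cong (λ i′ → sum-allFin≡∑< n (indicator i′)) (allFin (suc m))) ⟨
    sum (map (λ i′ → sum (map (indicator i′ ∘ toℕ) (allFin n))) (allFin (suc m)))
      ≡⟨ sum-map-cartesianProduct (λ u → indicator (proj₁ u) (toℕ (proj₂ u))) (allFin (suc m)) (allFin n) ⟨
    sum (map (λ u → indicator (proj₁ u) (toℕ (proj₂ u))) (vertices (suc m) n))
      ≡⟨ sum-map-filterᵇ (adj (suc m) n (i , j)) (λ u → G (proj₁ u) (toℕ (proj₂ u))) (vertices (suc m) n) ⟨
    sum (map (λ u → G (proj₁ u) (toℕ (proj₂ u))) (N (suc m) n (i , j))) ∎
    where
    open ≤-Reasoning
    t : ℕ
    t = toℕ j
    -- at s = toℕ j′ the condition is definitionally adj (suc m) n (i , j) (i′ , j′)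
    indicator : Fin (suc m) → ℕ → ℕ
    indicator i′ s = if (sameRow i i′ ∧ pathAdj t s) ∨ ((t ≡ᵇ s) ∧ cycleAdj m i i′) then G i′ s else 0

Column : ℕ → Set
Column c = Fin c → Lin

zeroColumn : ∀ {c} → Column c
zeroColumn _ = 0ₗ

-- A symbolic lower bound for Σ_{u ∈ N(i , t)} (f u ∸ 1) from the forms of columns t − 1, t, t + 1.
nbrForm : ∀ m → Fin (suc m) → (prev cur next : Column (suc m)) → Lin
nbrForm m i p c q = ∑ₗ (map (λ i′ → select (sameRow i i′) (cycleAdj m i i′)
                                       (predₗ (q i′) ⊕ predₗ (p i′)) (predₗ (c i′)) 0ₗ)
                            (allFin (suc m)))

module ByColumns (x y k : ℕ) (m n : ℕ) (col : ℕ → Column (suc m)) where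
  open Evaluation x y k

  f : Vertex (suc m) n → ℕ
  f (i , j) = ⟦ col (toℕ j) i ⟧

  G : Fin (suc m) → ℕ → ℕ
  G i s = ⟦ col s i ⟧ ∸ 1

  nbrFormAt : Fin (suc m) → ℕ → Lin
  nbrFormAt i t = nbrForm m i (before zeroColumn col t) (col t) (after zeroColumn n col t)

  ⟦predₗ-before⟧ : ∀ i t → ⟦ predₗ (before zeroColumn col t i) ⟧ ≤ before 0 (G i) t
  ⟦predₗ-before⟧ i zero    = z≤n
  ⟦predₗ-before⟧ i (suc t) = ⟦predₗ⟧ (col t i)

  ⟦predₗ-after⟧ : ∀ i t → ⟦ predₗ (after zeroColumn n col t i) ⟧ ≤ after 0 n (G i) t
  ⟦predₗ-after⟧ i t with suc t <ᵇ n
  ... | true  = ⟦predₗ⟧ (col (suc t) i)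
  ... | false = z≤n

  ⟦nbrFormAt⟧≤rowwiseBound : ∀ i t → ⟦ nbrFormAt i t ⟧ ≤ rowwiseBound m n G i t
  ⟦nbrFormAt⟧≤rowwiseBound i t = begin
    ⟦ nbrFormAt i t ⟧                           ≡⟨ ⟦∑ₗ⟧ (map row (allFin (suc m))) ⟩
    sum (map ⟦_⟧ (map row (allFin (suc m))))    ≡⟨ cong sum (map-∘ (allFin (suc m))) ⟨
    sum (map (⟦_⟧ ∘ row) (allFin (suc m)))      ≤⟨ sum-map-mono (allFin (suc m)) (λ i′ → rowBound i′ (sameRow i i′) (cycleAdj m i i′)) ⟩
    rowwiseBound m n G i t                      ∎
    where
    open ≤-Reasoning
    row : Fin (suc m) → Lin
    row i′ = select (sameRow i i′) (cycleAdj m i i′)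
               (predₗ (after zeroColumn n col t i′) ⊕ predₗ (before zeroColumn col t i′))
               (predₗ (col t i′)) 0ₗ
    rowBound : ∀ i′ r₁ r₂ →
      ⟦ select r₁ r₂ (predₗ (after zeroColumn n col t i′) ⊕ predₗ (before zeroColumn col t i′)) (predₗ (col t i′)) 0ₗ ⟧
        ≤ select r₁ r₂ (after 0 n (G i′) t + before 0 (G i′) t) (G i′ t) 0
    rowBound i′ true  r₂ = ≤-trans (≤-reflexive (⟦⊕⟧ (predₗ (after zeroColumn n col t i′)) (predₗ (before zeroColumn col t i′)))) (+-mono-≤ (⟦predₗ-after⟧ i′ t) (⟦predₗ-before⟧ i′ t))
    rowBound i′ false true  = ⟦predₗ⟧ (col t i′)
    rowBound i′ false false = z≤n

  isKRDF : (∀ i t → t < n → k ≤ ⟦ col t i ⊕ nbrFormAt i t ⟧) →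
           (∀ i t → t < n → ⟦ col t i ⟧ ≤ suc k) →
           IsKRDF k (suc m) n f
  isKRDF lower upper = record
    { range = λ (i , j) → upper i (toℕ j) (toℕ<n j)
    ; cond  = λ v _ → cond v }
    where
    cond : ∀ v → k + length (filterᵇ (λ u → 0 <ᵇ f u) (N (suc m) n v)) ≤ f v + sum (map f (N (suc m) n v))
    cond (i , j) = begin
      k + count                             ≤⟨ +-monoˡ-≤ count k≤f+∑pred ⟩
      f (i , j) + ∑pred + count             ≡⟨ +-assoc (f (i , j)) ∑pred count ⟩
      f (i , j) + (∑pred + count)           ≡⟨ cong (f (i , j) +_) (+-comm ∑pred count) ⟩
      f (i , j) + (count + ∑pred)           ≡⟨ cong (f (i , j) +_) (count-positive+sum-pred≡sum f (N (suc m) n (i , j))) ⟩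
      f (i , j) + sum (map f (N (suc m) n (i , j))) ∎
      where
      open ≤-Reasoning
      t count ∑pred : ℕ
      t = toℕ j
      count = length (filterᵇ (λ u → 0 <ᵇ f u) (N (suc m) n (i , j)))
      ∑pred = sum (map (λ u → f u ∸ 1) (N (suc m) n (i , j)))
      k≤f+∑pred : k ≤ f (i , j) + ∑pred
      k≤f+∑pred = begin
        k                                      ≤⟨ lower i t (toℕ<n j) ⟩
        ⟦ col t i ⊕ nbrFormAt i t ⟧            ≡⟨ ⟦⊕⟧ (col t i) (nbrFormAt i t) ⟩
        f (i , j) + ⟦ nbrFormAt i t ⟧          ≤⟨ +-monoʳ-≤ (f (i , j)) (≤-trans (⟦nbrFormAt⟧≤rowwiseBound i t) (rowwiseBound≤sum-N m n G i j)) ⟩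
        f (i , j) + ∑pred                      ∎

  weight≡∑<-columns : weight (suc m) n f ≡ ∑[ t < n ] ⟦ ∑ₗ (map (col t) (allFin (suc m))) ⟧
  weight≡∑<-columns = begin
    weight (suc m) n f
      ≡⟨ sum-map-cartesianProduct f (allFin (suc m)) (allFin n) ⟩
    sum (map (λ i → sum (map (λ j → ⟦ col (toℕ j) i ⟧) (allFin n))) (allFin (suc m)))
      ≡⟨ cong sum (map-cong (λ i → sum-allFin≡∑< n (λ t → ⟦ col t i ⟧)) (allFin (suc m))) ⟩
    sum (map (λ i → ∑[ t < n ] ⟦ col t i ⟧) (allFin (suc m)))
      ≡⟨ sum-∑<-comm n (λ i t → ⟦ col t i ⟧) (allFin (suc m)) ⟩
    ∑[ t < n ] sum (map (λ i → ⟦ col t i ⟧) (allFin (suc m)))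
      ≡⟨ ∑<-cong n (λ t _ → trans (cong sum (map-∘ (allFin (suc m)))) (sym (⟦∑ₗ⟧ (map (col t) (allFin (suc m)))))) ⟩
    ∑[ t < n ] ⟦ ∑ₗ (map (col t) (allFin (suc m))) ⟧ ∎
    where open ≡-Reasoning

module Certificate (x y k m : ℕ) {Col : Set} (form : Col → Column (suc m)) (lowers uppers : List Lin) where
  open Evaluation x y k

  okLower : Lin → Bool
  okLower L = any (_≤ᶜ L) lowers ∨ (k ≤ᵇ ⟦ L ⟧)

  okUpper : Lin → Bool
  okUpper L = any (L ≤ᶜ_) uppers ∨ (⟦ L ⟧ ≤ᵇ suc k)

  liftCol : Maybe Col → Column (suc m)
  liftCol nothing  = zeroColumn
  liftCol (just c) = form c

  -- For closed forms this computes even when x, y, k are variables, as long as every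
  -- comparison is settled by the coefficientwise test against lowers and uppers.
  columnOK : Maybe Col → Col → Maybe Col → Bool
  columnOK p c q = all (λ i → okLower (form c i ⊕ nbrForm m i (liftCol p) (form c) (liftCol q)) ∧ okUpper (form c i))
                       (allFin (suc m))

  columnsOK : ℕ → (ℕ → Col) → ℕ → Bool
  columnsOK n C t = columnOK (before nothing (just ∘ C) t) (C t) (after nothing n (just ∘ C) t)

  all-columnsOK : ∀ n C → T (all (columnsOK n C) (upTo n)) → ∀ t → t < n → T (columnsOK n C t)
  all-columnsOK n C ok t t<n = All.lookup (all⁺ (columnsOK n C) (upTo n) ok) (∈-upTo⁺ t<n)

  certified : ℕ → (ℕ → Col) → ℕ → Bool
  certified n C b = all (columnsOK n C) (upTo n) ∧ (weight (suc m) n (ByColumns.f x y k m n (form ∘ C)) ≤ᵇ b)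

  module _ (lowers-sound : All (λ H → k ≤ ⟦ H ⟧) lowers) (uppers-sound : All (λ U → ⟦ U ⟧ ≤ suc k) uppers) where

    okLower-sound : ∀ L → T (okLower L) → k ≤ ⟦ L ⟧
    okLower-sound L ok with Equivalence.to T-∨ ok
    ... | inj₁ some = let H , H∈ , H≤L = find (any⁻ (_≤ᶜ L) lowers some)
                      in ≤-trans (All.lookup lowers-sound H∈) (⟦⟧-mono H L H≤L)
    ... | inj₂ num  = ≤ᵇ⇒≤ k ⟦ L ⟧ num

    okUpper-sound : ∀ L → T (okUpper L) → ⟦ L ⟧ ≤ suc k
    okUpper-sound L ok with Equivalence.to T-∨ ok
    ... | inj₁ some = let U , U∈ , L≤U = find (any⁻ (L ≤ᶜ_) uppers some)
                      in ≤-trans (⟦⟧-mono L U L≤U) (All.lookup uppers-sound U∈)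
    ... | inj₂ num  = ≤ᵇ⇒≤ ⟦ L ⟧ (suc k) num

    columnsOK⇒isKRDF : ∀ n (C : ℕ → Col) → (∀ t → t < n → T (columnsOK n C t)) →
      IsKRDF k (suc m) n (ByColumns.f x y k m n (form ∘ C))
    columnsOK⇒isKRDF n C ok = isKRDF lower upper
      where
      open ByColumns x y k m n (form ∘ C)
      rowOK : ∀ i t → t < n → T (okLower (form (C t) i ⊕ nbrFormAt i t)) × T (okUpper (form (C t) i))
      rowOK i t t<n
        rewrite sym (before-map liftCol nothing (just ∘ C) t) | sym (after-map liftCol nothing n (just ∘ C) t)
        = Equivalence.to T-∧ (All.lookup (all⁺ _ (allFin (suc m)) (ok t t<n)) (∈-allFin i))
      lower : ∀ i t → t < n → k ≤ ⟦ form (C t) i ⊕ nbrFormAt i t ⟧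
      lower i t t<n = okLower-sound (form (C t) i ⊕ nbrFormAt i t) (proj₁ (rowOK i t t<n))
      upper : ∀ i t → t < n → ⟦ form (C t) i ⟧ ≤ suc k
      upper i t t<n = okUpper-sound (form (C t) i) (proj₂ (rowOK i t t<n))

    certified-sound : ∀ n C b → T (certified n C b) → γ[ k ]R-CP≤ (suc m) n b
    certified-sound n C b ok =
      ByColumns.f x y k m n (form ∘ C) ,
      columnsOK⇒isKRDF n C (all-columnsOK n C columns-ok) ,
      ≤ᵇ⇒≤ (weight (suc m) n (ByColumns.f x y k m n (form ∘ C))) b weight-ok
      where
      columns-ok : T (all (columnsOK n C) (upTo n))
      columns-ok = proj₁ (Equivalence.to T-∧ ok)
      weight-ok : T (weight (suc m) n (ByColumns.f x y k m n (form ∘ C)) ≤ᵇ b)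
      weight-ok = proj₂ (Equivalence.to T-∧ ok)

-- The parameters q and B

m≤⌈m/1+n⌉*[1+n] : ∀ a b → a ≤ ⌈ a /suc b ⌉ * suc b
m≤⌈m/1+n⌉*[1+n] a b = +-cancelˡ-≤ b a _ (begin
  b + a                                          ≡⟨ +-comm b a ⟩
  a + b                                          ≡⟨ m≡m%n+[m/n]*n (a + b) (suc b) ⟩
  (a + b) % suc b + ⌈ a /suc b ⌉ * suc b         ≤⟨ +-monoˡ-≤ _ (m<1+n⇒m≤n (m%n<n (a + b) (suc b))) ⟩
  b + ⌈ a /suc b ⌉ * suc b                       ∎)
  where open ≤-Reasoning

⌈m/1+n⌉*[1+n]≤m+n : ∀ a b → ⌈ a /suc b ⌉ * suc b ≤ a + b
⌈m/1+n⌉*[1+n]≤m+n a b = m/n*n≤m (a + b) (suc b)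

q : ℕ → ℕ
q k = ⌈ k + 5 /suc 4 ⌉

B : ℕ → ℕ
B k = ⌈ (k + 3) ∸ q k /suc 2 ⌉

bound : ℕ → ℕ → ℕ
bound n k = (8 * (n ∸ 2) * q k + 16 * B k) ∸ 2 * (n ∸ n / 3)

n∸n/3-period : ∀ n → (3 + n) ∸ (3 + n) / 3 ≡ n ∸ n / 3 + 2
n∸n/3-period n = begin
  (3 + n) ∸ (3 + n) / 3     ≡⟨ cong ((3 + n) ∸_) (+-distrib-/-∣ˡ n (∣-refl {3})) ⟩
  (2 + n) ∸ n / 3           ≡⟨ cong (_∸ n / 3) (+-comm 2 n) ⟩
  (n + 2) ∸ n / 3           ≡⟨ +-∸-comm 2 (m/n≤m n 3) ⟩
  n ∸ n / 3 + 2             ∎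
  where open ≡-Reasoning

module Parameters (k : ℕ) (1≤k : 1 ≤ k) where

  k+5≤5q : k + 5 ≤ 5 * q k
  k+5≤5q = subst (k + 5 ≤_) (*-comm (q k) 5) (m≤⌈m/1+n⌉*[1+n] (k + 5) 4)

  5q≤k+9 : 5 * q k ≤ k + 9
  5q≤k+9 = subst₂ _≤_ (*-comm (q k) 5) (+-assoc k 5 4) (⌈m/1+n⌉*[1+n]≤m+n (k + 5) 4)

  2≤q : 2 ≤ q k
  2≤q = *-cancelˡ-< 5 1 (q k) (≤-trans (+-monoˡ-≤ 5 1≤k) k+5≤5q)

  q≤k+1 : q k ≤ k + 1
  q≤k+1 = *-cancelˡ-≤ 5 (begin
    5 * q k              ≤⟨ 5q≤k+9 ⟩
    k + 9                ≤⟨ +-monoʳ-≤ k (+-monoˡ-≤ 5 (*-monoʳ-≤ 4 1≤k)) ⟩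
    k + (4 * k + 5)      ≡⟨ eq k ⟩
    5 * (k + 1)          ∎)
    where
    open ≤-Reasoning
    eq : ∀ k → k + (4 * k + 5) ≡ 5 * (k + 1)
    eq = solve-∀

  q≤k : 3 ≤ k → q k ≤ k
  q≤k 3≤k = *-cancelˡ-≤ 5 (begin
    5 * q k              ≤⟨ 5q≤k+9 ⟩
    k + 9                ≤⟨ +-monoʳ-≤ k (≤-trans (m≤m+n 9 3) (*-monoʳ-≤ 4 3≤k)) ⟩
    k + 4 * k            ≡⟨ eq k ⟩
    5 * k                ∎)
    where
    open ≤-Reasoning
    eq : ∀ k → k + 4 * k ≡ 5 * k
    eq = solve-∀

  3≤q : 6 ≤ k → 3 ≤ q k
  3≤q 6≤k = *-cancelˡ-< 5 2 (q k) (≤-trans (+-monoˡ-≤ 5 6≤k) k+5≤5q)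

  [k+3∸q]+q≡k+3 : (k + 3) ∸ q k + q k ≡ k + 3
  [k+3∸q]+q≡k+3 = m∸n+n≡m (≤-trans q≤k+1 (+-monoʳ-≤ k (s≤s z≤n)))

  k+3≤q+3B : k + 3 ≤ q k + 3 * B k
  k+3≤q+3B = begin
    k + 3                       ≡⟨ [k+3∸q]+q≡k+3 ⟨
    (k + 3) ∸ q k + q k         ≤⟨ +-monoˡ-≤ (q k) (m≤⌈m/1+n⌉*[1+n] ((k + 3) ∸ q k) 2) ⟩
    B k * 3 + q k               ≡⟨ cong (_+ q k) (*-comm (B k) 3) ⟩
    3 * B k + q k               ≡⟨ +-comm (3 * B k) (q k) ⟩
    q k + 3 * B k               ∎
    where open ≤-Reasoning

  3B≤k+3 : 3 * B k ≤ k + 3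
  3B≤k+3 = begin
    3 * B k                     ≡⟨ *-comm 3 (B k) ⟩
    B k * 3                     ≤⟨ ⌈m/1+n⌉*[1+n]≤m+n ((k + 3) ∸ q k) 2 ⟩
    (k + 3) ∸ q k + 2           ≤⟨ +-monoʳ-≤ ((k + 3) ∸ q k) 2≤q ⟩
    (k + 3) ∸ q k + q k         ≡⟨ [k+3∸q]+q≡k+3 ⟩
    k + 3                       ∎
    where open ≤-Reasoning

  B≤k : B k ≤ k
  B≤k = m<1+n⇒m≤n (*-cancelˡ-< 3 (B k) (suc k) (begin-strict
    3 * B k                     ≤⟨ 3B≤k+3 ⟩
    k + 3                       <⟨ m<m+n (k + 3) (≤-trans 1≤k (m≤n*m k 2)) ⟩
    k + 3 + 2 * k               ≡⟨ eq k ⟩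
    3 * suc k                   ∎))
    where
    open ≤-Reasoning
    eq : ∀ k → k + 3 + 2 * k ≡ 3 * suc k
    eq = solve-∀

  k+[4+c]≤4q+B : ∀ c → 15 * c ≤ k + 10 → k + (4 + c) ≤ 4 * q k + B k
  k+[4+c]≤4q+B c 15c≤k+10 = *-cancelˡ-≤ 15 (begin
    15 * (k + (4 + c))                    ≡⟨ eq₁ k c ⟩
    15 * k + 60 + 15 * c                  ≤⟨ +-monoʳ-≤ (15 * k + 60) 15c≤k+10 ⟩
    15 * k + 60 + (k + 10)                ≡⟨ eq₂ k ⟩
    11 * (k + 5) + 5 * (k + 3)            ≤⟨ +-mono-≤ (*-monoʳ-≤ 11 k+5≤5q) (*-monoʳ-≤ 5 k+3≤q+3B) ⟩
    11 * (5 * q k) + 5 * (q k + 3 * B k)  ≡⟨ eq₃ (q k) (B k) ⟩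
    15 * (4 * q k + B k)                  ∎)
    where
    open ≤-Reasoning
    eq₁ : ∀ k c → 15 * (k + (4 + c)) ≡ 15 * k + 60 + 15 * c
    eq₁ = solve-∀
    eq₂ : ∀ k → 15 * k + 60 + (k + 10) ≡ 11 * (k + 5) + 5 * (k + 3)
    eq₂ = solve-∀
    eq₃ : ∀ q B → 11 * (5 * q) + 5 * (q + 3 * B) ≡ 15 * (4 * q + B)
    eq₃ = solve-∀

  1≤B : 1 ≤ B k
  1≤B = *-cancelˡ-< 3 0 (B k) (+-cancelˡ-< (q k) 0 (3 * B k) (begin-strict
    q k + 0                     ≡⟨ +-identityʳ (q k) ⟩
    q k                         ≤⟨ q≤k+1 ⟩
    k + 1                       <⟨ +-monoʳ-< k (s≤s (s≤s z≤n)) ⟩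
    k + 3                       ≤⟨ k+3≤q+3B ⟩
    q k + 3 * B k               ∎))
    where open ≤-Reasoning

module Shifted (k : ℕ) (1≤k : 1 ≤ k) (s : ℕ) (s≤q : s ≤ q k) where
  open Parameters k 1≤k

  x y : ℕ
  x = q k ∸ s
  y = B k ∸ 1

  open Evaluation x y k public

  q≡x+s : q k ≡ x + s
  q≡x+s = sym (m∸n+n≡m s≤q)

  B≡y+1 : B k ≡ y + 1
  B≡y+1 = sym (m∸n+n≡m 1≤B)

  ⟦q⟧ : ⟦ lin 1 0 0 s ⟧ ≡ q k
  ⟦q⟧ = trans (eq x y k s) (sym q≡x+s)
    where
    eq : ∀ x y k s → 1 * x + 0 * y + 0 * k + s ≡ x + s
    eq = solve-∀

  ⟦B+1⟧ : ⟦ lin 0 1 0 2 ⟧ ≡ B k + 1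
  ⟦B+1⟧ = trans (eq x y k) (cong (_+ 1) (sym B≡y+1))
    where
    eq : ∀ x y k → 0 * x + 1 * y + 0 * k + 2 ≡ y + 1 + 1
    eq = solve-∀

  ⟦5q⟧ : ⟦ lin 5 0 0 (5 * s) ⟧ ≡ 5 * q k
  ⟦5q⟧ = trans (eq x y k s) (cong (5 *_) (sym q≡x+s))
    where
    eq : ∀ x y k s → 5 * x + 0 * y + 0 * k + 5 * s ≡ 5 * (x + s)
    eq = solve-∀

  ⟦q+3B⟧ : ⟦ lin 1 3 0 (s + 3) ⟧ ≡ q k + 3 * B k
  ⟦q+3B⟧ = trans (eq x y k s) (sym (cong₂ (λ a b → a + 3 * b) q≡x+s B≡y+1))
    where
    eq : ∀ x y k s → 1 * x + 3 * y + 0 * k + (s + 3) ≡ x + s + 3 * (y + 1)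
    eq = solve-∀

  ⟦4q+B⟧ : ⟦ lin 4 1 0 (4 * s + 1) ⟧ ≡ 4 * q k + B k
  ⟦4q+B⟧ = trans (eq x y k s) (sym (cong₂ (λ a b → 4 * a + b) q≡x+s B≡y+1))
    where
    eq : ∀ x y k s → 4 * x + 1 * y + 0 * k + (4 * s + 1) ≡ 4 * (x + s) + (y + 1)
    eq = solve-∀

  k≤q+3B∸3 : k ≤ ⟦ lin 1 3 0 s ⟧
  k≤q+3B∸3 = lower-shift 1 3 0 s 3 (subst (k + 3 ≤_) (sym ⟦q+3B⟧) k+3≤q+3B)

  ⟦B+1⟧≤1+k : ⟦ lin 0 1 0 2 ⟧ ≤ suc k
  ⟦B+1⟧≤1+k = subst₂ _≤_ (sym ⟦B+1⟧) (+-comm k 1) (+-monoˡ-≤ 1 B≤k)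

-- The staggered design

staggeredForm : Bool → Column 8
staggeredForm true  i = if toℕ i % 4 ≡ᵇ 0 then lin 0 0 1 1 else 0ₗ
staggeredForm false i = if toℕ i % 4 ≡ᵇ 2 then lin 0 0 1 1 else 0ₗ

even : ℕ → Bool
even zero    = true
even (suc t) = not (even t)

module Staggered (k : ℕ) where
  open Certificate 0 0 k 7 staggeredForm (lin 0 0 1 0 ∷ []) (lin 0 0 1 1 ∷ [])

  staggered-columnsOK : ∀ n → 2 ≤ n → ∀ t → t < n → T (columnsOK n even t)
  staggered-columnsOK (suc (suc n)) _         zero    _ = tt
  staggered-columnsOK (suc zero)    (s≤s ()) zero    _
  staggered-columnsOK n             _         (suc t) _ = interior (even t) (suc (suc t) <ᵇ n)
    where
    interior : ∀ b c → T (columnOK (just b) (not b) (if c then just (not (not b)) else nothing))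
    interior true  true  = tt
    interior true  false = tt
    interior false true  = tt
    interior false false = tt

  staggered-isKRDF : ∀ n → 2 ≤ n → IsKRDF k 8 n (ByColumns.f 0 0 k 7 n (staggeredForm ∘ even))
  staggered-isKRDF n 2≤n = columnsOK⇒isKRDF (≤-reflexive (eq₀ k) All.∷ All.[]) (≤-reflexive (eq₁ k) All.∷ All.[])
                                        n even (staggered-columnsOK n 2≤n)
    where
    eq₀ : ∀ k → k ≡ 0 * 0 + 0 * 0 + 1 * k + 0
    eq₀ = solve-∀
    eq₁ : ∀ k → 0 * 0 + 0 * 0 + 1 * k + 1 ≡ suc k
    eq₁ = solve-∀

  staggered-weight : ∀ n → weight 8 n (ByColumns.f 0 0 k 7 n (staggeredForm ∘ even)) ≡ n * (2 * k + 2)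
  staggered-weight n = begin
    weight 8 n (ByColumns.f 0 0 k 7 n (staggeredForm ∘ even))
      ≡⟨ ByColumns.weight≡∑<-columns 0 0 k 7 n (staggeredForm ∘ even) ⟩
    ∑[ t < n ] ⟦ ∑ₗ (map (staggeredForm (even t)) (allFin 8)) ⟧
      ≡⟨ ∑<-cong n (λ t _ → column (even t)) ⟩
    ∑[ t < n ] (2 * k + 2)
      ≡⟨ ∑<-const n (2 * k + 2) ⟩
    n * (2 * k + 2) ∎
    where
    open ≡-Reasoning
    open Evaluation 0 0 k
    eq : ∀ k → 0 * 0 + 0 * 0 + 2 * k + 2 ≡ 2 * k + 2
    eq = solve-∀
    column : ∀ b → ⟦ ∑ₗ (map (staggeredForm b) (allFin 8)) ⟧ ≡ 2 * k + 2
    column true  = eq k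
    column false = eq k

γ-k=5 : ∀ n → 2 ≤ n → γ[ 5 ]R-CP≤ 8 n (bound n 5)
γ-k=5 n 2≤n = _ , staggered-isKRDF n 2≤n , ≤-trans (≤-reflexive (staggered-weight n)) (12n≤bound n 2≤n)
  where
  open Staggered 5
  12n≤bound : ∀ n → 2 ≤ n → n * 12 ≤ bound n 5
  12n≤bound (suc zero)    (s≤s ())
  12n≤bound (suc (suc n)) _ = m+n≤o⇒m≤o∸n (suc (suc n) * 12) (begin
    suc (suc n) * 12 + 2 * (suc (suc n) ∸ suc (suc n) / 3)  ≤⟨ +-monoʳ-≤ (suc (suc n) * 12) (*-monoʳ-≤ 2 (m∸n≤m (suc (suc n)) (suc (suc n) / 3))) ⟩
    suc (suc n) * 12 + 2 * suc (suc n)                       ≤⟨ m≤m+n (suc (suc n) * 12 + 2 * suc (suc n)) (2 * n + 4) ⟩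
    suc (suc n) * 12 + 2 * suc (suc n) + (2 * n + 4)         ≡⟨ eq n ⟩
    8 * n * 2 + 16 * 2                                       ∎)
    where
    open ≤-Reasoning
    eq : ∀ n → suc (suc n) * 12 + 2 * suc (suc n) + (2 * n + 4) ≡ 8 * n * 2 + 16 * 2
    eq = solve-∀

-- The general design

data GCol : Set where
  E₁ E₃ D₁ D₃ I₁ I₃ I₀ : GCol

-- Evaluated at x = q k ∸ 2 and y = B k ∸ 1, i.e. Shifted with s = 2.
[q] [q-1] [B] [B+1] : Lin
[q]   = lin 1 0 0 2
[q-1] = lin 1 0 0 1
[B]   = lin 0 1 0 1
[B+1] = lin 0 1 0 2

gForm : GCol → Column 8
gForm E₁ i = if toℕ i % 4 ≡ᵇ 1 then [B+1] else [B]
gForm E₃ i = if toℕ i % 4 ≡ᵇ 3 then [B+1] else [B]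
gForm D₁ i = if toℕ i % 4 ≡ᵇ 1 then [q] else [q-1]
gForm D₃ i = if toℕ i % 4 ≡ᵇ 3 then [q] else [q-1]
gForm I₁ i = if toℕ i % 4 ≡ᵇ 1 then [q-1] else [q]
gForm I₃ i = if toℕ i % 4 ≡ᵇ 3 then [q-1] else [q]
gForm I₀ i = [q]

data Phase : Set where
  φ₃ φ₁ φ₀ : Phase

nextPhase : Phase → Phase
nextPhase φ₃ = φ₁
nextPhase φ₁ = φ₀
nextPhase φ₀ = φ₃

phase : ℕ → Phase
phase zero    = φ₃
phase (suc t) = nextPhase (phase t)

interiorCol penultimateCol lastCol : Phase → GCol
interiorCol φ₃ = I₃
interiorCol φ₁ = I₁
interiorCol φ₀ = I₀
penultimateCol φ₁ = D₁
penultimateCol φ₃ = D₃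
penultimateCol φ₀ = D₃
lastCol φ₁ = E₃
lastCol φ₃ = E₁
lastCol φ₀ = E₁

-- The column with t columns to its left and d to its right.
gColAt : ℕ → ℕ → GCol
gColAt zero          d                   = E₁
gColAt (suc t)       zero                = lastCol (phase (t ∸ 2))
gColAt (suc zero)    (suc d)             = D₃
gColAt (suc (suc t)) (suc zero)          = penultimateCol (phase t)
gColAt (suc (suc t)) (suc (suc zero))    = I₀
gColAt (suc (suc t)) (suc (suc (suc d))) = interiorCol (phase (suc (suc t)))

leftOf rightOf : ℕ → ℕ → Maybe GCol
leftOf zero    d = nothing
leftOf (suc t) d = just (gColAt t (suc d))
rightOf t zero    = nothing
rightOf t (suc d) = just (gColAt (suc t) d)

gColumns : ℕ → ℕ → GCol
gColumns n t = gColAt t (n ∸ suc t)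

-- 5q − 10 + s, q + 3B − 3 and 4q + B − 9 + g.
gLowers : ℕ → ℕ → List Lin
gLowers s g = lin 5 0 0 s ∷ lin 1 3 0 2 ∷ lin 4 1 0 g ∷ []

gUppers : List Lin
gUppers = [B+1] ∷ [q] ∷ []

m<ᵇm+n≡0<ᵇn : ∀ m n → (m <ᵇ m + n) ≡ (0 <ᵇ n)
m<ᵇm+n≡0<ᵇn zero    n = refl
m<ᵇm+n≡0<ᵇn (suc m) n = m<ᵇm+n≡0<ᵇn m n

before-gColumns : ∀ t d → before nothing (just ∘ gColumns (suc (t + d))) t ≡ leftOf t d
before-gColumns zero    d = refl
before-gColumns (suc t) d = cong (λ e → just (gColAt t e)) (trans (cong (_∸ t) (sym (+-suc t d))) (m+n∸m≡n t (suc d)))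

gColumns-at : ∀ t d → gColumns (suc (t + d)) t ≡ gColAt t d
gColumns-at t d = cong (gColAt t) (m+n∸m≡n t d)

after-gColumns : ∀ t d → after nothing (suc (t + d)) (just ∘ gColumns (suc (t + d))) t ≡ rightOf t d
after-gColumns t zero    rewrite m<ᵇm+n≡0<ᵇn t 0 = refl
after-gColumns t (suc d) rewrite m<ᵇm+n≡0<ᵇn t (suc d) =
  cong (λ e → just (gColAt (suc t) e)) (trans (cong (_∸ suc t) (+-suc t d)) (m+n∸m≡n t d))

module GChecks (x y k : ℕ) where
  open Certificate x y k 7 gForm

  columnsOK-gColumns : ∀ Hs Us t d → T (columnOK Hs Us (leftOf t d) (gColAt t d) (rightOf t d)) →
    T (columnsOK Hs Us (suc (t + d)) (gColumns (suc (t + d))) t)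
  columnsOK-gColumns Hs Us t d ok rewrite before-gColumns t d | gColumns-at t d | after-gColumns t d = ok

  private
    OK : Maybe GCol → GCol → Maybe GCol → Set
    OK p c r = T (columnOK (gLowers 5 3) gUppers p c r)

  last-OK : ∀ p → OK (just (penultimateCol p)) (lastCol p) nothing
  last-OK φ₃ = tt
  last-OK φ₁ = tt
  last-OK φ₀ = tt

  penultimate-OK : ∀ p → OK (just I₀) (penultimateCol p) (just (lastCol p))
  penultimate-OK φ₃ = tt
  penultimate-OK φ₁ = tt
  penultimate-OK φ₀ = tt

  antepenultimate-OK : ∀ p → OK (just (interiorCol p)) I₀ (just (penultimateCol p))
  antepenultimate-OK φ₃ = tt
  antepenultimate-OK φ₁ = tt
  antepenultimate-OK φ₀ = tt

  interior-OK : ∀ p → OK (just (interiorCol p)) (interiorCol (nextPhase p)) (just (interiorCol (nextPhase (nextPhase p))))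
  interior-OK φ₃ = tt
  interior-OK φ₁ = tt
  interior-OK φ₀ = tt

  before-antepenultimate-OK : ∀ p → OK (just (interiorCol p)) (interiorCol (nextPhase p)) (just I₀)
  before-antepenultimate-OK φ₃ = tt
  before-antepenultimate-OK φ₁ = tt
  before-antepenultimate-OK φ₀ = tt

  gColAt-OK : ∀ t d → T (5 ≤ᵇ t + d) → OK (leftOf t d) (gColAt t d) (rightOf t d)
  gColAt-OK 0 (suc (suc (suc (suc (suc d))))) _ = tt
  gColAt-OK 1 (suc (suc (suc (suc d))))       _ = tt
  gColAt-OK 2 (suc (suc (suc zero)))          _ = tt
  gColAt-OK 2 (suc (suc (suc (suc d))))       _ = tt
  gColAt-OK (suc (suc (suc t))) 0                           _ = last-OK (phase t)
  gColAt-OK (suc (suc (suc t))) 1                           _ = penultimate-OK (phase (suc t))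
  gColAt-OK (suc (suc (suc t))) 2                           _ = antepenultimate-OK (phase (suc (suc t)))
  gColAt-OK (suc (suc (suc t))) 3                           _ = before-antepenultimate-OK (phase (suc (suc t)))
  gColAt-OK (suc (suc (suc t))) (suc (suc (suc (suc d))))  _ = interior-OK (phase (suc (suc t)))
  gColAt-OK 0 0 ()
  gColAt-OK 0 1 ()
  gColAt-OK 0 2 ()
  gColAt-OK 0 3 ()
  gColAt-OK 0 4 ()
  gColAt-OK 1 0 ()
  gColAt-OK 1 1 ()
  gColAt-OK 1 2 ()
  gColAt-OK 1 3 ()
  gColAt-OK 2 0 ()
  gColAt-OK 2 1 ()
  gColAt-OK 2 2 ()

  gColumns-OK : ∀ n → 6 ≤ n → ∀ t → t < n → T (columnsOK (gLowers 5 3) gUppers n (gColumns n) t)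
  gColumns-OK n 6≤n t t<n = at (n ∸ suc t) (m+[n∸m]≡n t<n) 6≤n
    where
    at : ∀ d {n} → suc (t + d) ≡ n → 6 ≤ n → T (columnsOK (gLowers 5 3) gUppers n (gColumns n) t)
    at d refl (s≤s 5≤t+d) = columnsOK-gColumns (gLowers 5 3) gUppers t d (gColAt-OK t d (≤⇒≤ᵇ 5≤t+d))

module GDesign (k : ℕ) (1≤k : 1 ≤ k) where
  open Parameters k 1≤k
  open Shifted k 1≤k 2 2≤q public

  f : (n : ℕ) → Vertex 8 n → ℕ
  f n = ByColumns.f x y k 7 n (gForm ∘ gColumns n)

  w : GCol → ℕ
  w c = ⟦ ∑ₗ (map (gForm c) (allFin 8)) ⟧

  W : ℕ → ℕ
  W n = ∑[ t < n ] w (gColumns n t)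

  weight≡W : ∀ n → weight 8 n (f n) ≡ W n
  weight≡W n = ByColumns.weight≡∑<-columns x y k 7 n (gForm ∘ gColumns n)

  w-penultimate : ∀ p → w (penultimateCol p) ≡ ⟦ lin 8 0 0 10 ⟧
  w-penultimate φ₃ = refl
  w-penultimate φ₁ = refl
  w-penultimate φ₀ = refl

  w-last : ∀ p → w (lastCol p) ≡ ⟦ lin 0 8 0 10 ⟧
  w-last φ₃ = refl
  w-last φ₁ = refl
  w-last φ₀ = refl

  w-period : ∀ p → w (interiorCol p) + w (interiorCol (nextPhase p)) + w (interiorCol (nextPhase (nextPhase p)))
                   ≡ ⟦ lin 24 0 0 44 ⟧
  w-period p = trans (cong (_+ w (interiorCol (nextPhase (nextPhase p)))) (sym (⟦⊕⟧ (cw p) (cw (nextPhase p)))))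
                     (trans (sym (⟦⊕⟧ (cw p ⊕ cw (nextPhase p)) (cw (nextPhase (nextPhase p))))) (cong ⟦_⟧ (period p)))
    where
    cw : Phase → Lin
    cw p = ∑ₗ (map (gForm (interiorCol p)) (allFin 8))
    period : ∀ p → cw p ⊕ cw (nextPhase p) ⊕ cw (nextPhase (nextPhase p)) ≡ lin 24 0 0 44
    period φ₃ = refl
    period φ₁ = refl
    period φ₀ = refl

  prefix : ℕ → ℕ
  prefix N = ∑[ t < N ] w (gColAt t 3)

  gColAt-far : ∀ t d → gColAt t (3 + d) ≡ gColAt t 3
  gColAt-far zero                d = refl
  gColAt-far (suc zero)          d = refl
  gColAt-far (suc (suc t))       d = refl

  prefix-period : ∀ N → prefix (5 + N) ≡ prefix (2 + N) + ⟦ lin 24 0 0 44 ⟧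
  prefix-period N = begin
    prefix (5 + N)
      ≡⟨ trans (∑<-snoc (4 + N) Q) (cong (_+ Q (4 + N)) (trans (∑<-snoc (3 + N) Q) (cong (_+ Q (3 + N)) (∑<-snoc (2 + N) Q)))) ⟩
    prefix (2 + N) + Q (2 + N) + Q (3 + N) + Q (4 + N)
      ≡⟨ trans (+-assoc (prefix (2 + N) + Q (2 + N)) _ _) (+-assoc (prefix (2 + N)) _ _) ⟩
    prefix (2 + N) + (Q (2 + N) + (Q (3 + N) + Q (4 + N)))
      ≡⟨ cong (prefix (2 + N) +_) (trans (sym (+-assoc (Q (2 + N)) _ _)) (w-period (phase (2 + N)))) ⟩
    prefix (2 + N) + ⟦ lin 24 0 0 44 ⟧ ∎
    where
    open ≡-Reasoning
    Q : ℕ → ℕ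
    Q t = w (gColAt t 3)

  W-split : ∀ N → W (5 + N) ≡ prefix (2 + N) + ⟦ lin 8 0 0 16 ⟧ + ⟦ lin 8 0 0 10 ⟧ + ⟦ lin 0 8 0 10 ⟧
  W-split N = begin
    W (5 + N)
      ≡⟨ trans (∑<-snoc (4 + N) Q) (cong (_+ Q (4 + N)) (trans (∑<-snoc (3 + N) Q) (cong (_+ Q (3 + N)) (∑<-snoc (2 + N) Q)))) ⟩
    ∑< (2 + N) Q + Q (2 + N) + Q (3 + N) + Q (4 + N)
      ≡⟨ cong₂ _+_ (cong₂ _+_ (cong₂ _+_ left antepenultimate) penultimate) last ⟩
    prefix (2 + N) + ⟦ lin 8 0 0 16 ⟧ + ⟦ lin 8 0 0 10 ⟧ + ⟦ lin 0 8 0 10 ⟧ ∎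
    where
    open ≡-Reasoning
    Q : ℕ → ℕ
    Q t = w (gColumns (5 + N) t)
    left : ∑< (2 + N) Q ≡ prefix (2 + N)
    left = ∑<-cong (2 + N) (λ t t<2+N → cong w (trans (cong (gColAt t) (+-∸-assoc 3 t<2+N)) (gColAt-far t _)))
    antepenultimate : Q (2 + N) ≡ ⟦ lin 8 0 0 16 ⟧
    antepenultimate rewrite m+n∸n≡m 2 N = refl
    penultimate : Q (3 + N) ≡ ⟦ lin 8 0 0 10 ⟧
    penultimate rewrite m+n∸n≡m 1 N = w-penultimate (phase (suc N))
    last : Q (4 + N) ≡ ⟦ lin 0 8 0 10 ⟧
    last rewrite n∸n≡0 N = w-last (phase (suc N))

  W-period : ∀ p → W (8 + p) ≡ W (5 + p) + ⟦ lin 24 0 0 44 ⟧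
  W-period p = begin
    W (8 + p)                                          ≡⟨ W-split (3 + p) ⟩
    prefix (5 + p) + I + D + E                         ≡⟨ cong (λ a → a + I + D + E) (prefix-period p) ⟩
    prefix (2 + p) + ⟦ lin 24 0 0 44 ⟧ + I + D + E     ≡⟨ rearrange (prefix (2 + p)) ⟦ lin 24 0 0 44 ⟧ I D E ⟩
    prefix (2 + p) + I + D + E + ⟦ lin 24 0 0 44 ⟧     ≡⟨ cong (_+ ⟦ lin 24 0 0 44 ⟧) (W-split p) ⟨
    W (5 + p) + ⟦ lin 24 0 0 44 ⟧                      ∎
    where
    open ≡-Reasoning
    I D E : ℕ
    I = ⟦ lin 8 0 0 16 ⟧
    D = ⟦ lin 8 0 0 10 ⟧
    E = ⟦ lin 0 8 0 10 ⟧
    rearrange : ∀ a b c d e → a + b + c + d + e ≡ a + c + d + e + b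
    rearrange = solve-∀

  W+2[n∸n/3] : ∀ p → W (5 + p) + 2 * ((5 + p) ∸ (5 + p) / 3) ≡ 8 * (3 + p) * (x + 2) + 16 * (y + 1)
  W+2[n∸n/3] 0 = trans (cong (_+ 8) (∑<-⟦⟧ 5 (λ t → ∑ₗ (map (gForm (gColumns 5 t)) (allFin 8))))) (eq x y k)
    where
    eq : ∀ x y k → 24 * x + 16 * y + 0 * k + 56 + 8 ≡ 8 * 3 * (x + 2) + 16 * (y + 1)
    eq = solve-∀
  W+2[n∸n/3] 1 = trans (cong (_+ 8) (∑<-⟦⟧ 6 (λ t → ∑ₗ (map (gForm (gColumns 6 t)) (allFin 8))))) (eq x y k)
    where
    eq : ∀ x y k → 32 * x + 16 * y + 0 * k + 72 + 8 ≡ 8 * 4 * (x + 2) + 16 * (y + 1)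
    eq = solve-∀
  W+2[n∸n/3] 2 = trans (cong (_+ 10) (∑<-⟦⟧ 7 (λ t → ∑ₗ (map (gForm (gColumns 7 t)) (allFin 8))))) (eq x y k)
    where
    eq : ∀ x y k → 40 * x + 16 * y + 0 * k + 86 + 10 ≡ 8 * 5 * (x + 2) + 16 * (y + 1)
    eq = solve-∀
  W+2[n∸n/3] (suc (suc (suc p))) = begin
    W (8 + p) + 2 * ((8 + p) ∸ (8 + p) / 3)
      ≡⟨ cong₂ (λ a b → a + 2 * b) (W-period p) (n∸n/3-period (5 + p)) ⟩
    W (5 + p) + ⟦ lin 24 0 0 44 ⟧ + 2 * ((5 + p) ∸ (5 + p) / 3 + 2)
      ≡⟨ eq (W (5 + p)) ((5 + p) ∸ (5 + p) / 3) x y k ⟩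
    W (5 + p) + 2 * ((5 + p) ∸ (5 + p) / 3) + (24 * x + 48)
      ≡⟨ cong (_+ (24 * x + 48)) (W+2[n∸n/3] p) ⟩
    8 * (3 + p) * (x + 2) + 16 * (y + 1) + (24 * x + 48)
      ≡⟨ eq′ p x y ⟩
    8 * (6 + p) * (x + 2) + 16 * (y + 1) ∎
    where
    open ≡-Reasoning
    eq : ∀ w d x y k → w + (24 * x + 0 * y + 0 * k + 44) + 2 * (d + 2) ≡ w + 2 * d + (24 * x + 48)
    eq = solve-∀
    eq′ : ∀ p x y → 8 * (3 + p) * (x + 2) + 16 * (y + 1) + (24 * x + 48) ≡ 8 * (6 + p) * (x + 2) + 16 * (y + 1)
    eq′ = solve-∀

  k≤5q∸5 : k ≤ ⟦ lin 5 0 0 5 ⟧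
  k≤5q∸5 = lower-shift 5 0 0 5 5 (subst (k + 5 ≤_) (sym ⟦5q⟧) k+5≤5q)

  k≤5q∸6 : k + 6 ≤ 5 * q k → k ≤ ⟦ lin 5 0 0 4 ⟧
  k≤5q∸6 k+6≤5q = lower-shift 5 0 0 4 6 (subst (k + 6 ≤_) (sym ⟦5q⟧) k+6≤5q)

  k≤4q+B∸6 : 20 ≤ k → k ≤ ⟦ lin 4 1 0 3 ⟧
  k≤4q+B∸6 20≤k = lower-shift 4 1 0 3 6 (subst (k + 6 ≤_) (sym ⟦4q+B⟧) (k+[4+c]≤4q+B 2 (+-monoˡ-≤ 10 20≤k)))

  k≤4q+B∸7 : 35 ≤ k → k ≤ ⟦ lin 4 1 0 2 ⟧
  k≤4q+B∸7 35≤k = lower-shift 4 1 0 2 7 (subst (k + 7 ≤_) (sym ⟦4q+B⟧) (k+[4+c]≤4q+B 3 (+-monoˡ-≤ 10 35≤k)))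

  gLowers-sound : ∀ s g → k ≤ ⟦ lin 5 0 0 s ⟧ → k ≤ ⟦ lin 4 1 0 g ⟧ → All (λ H → k ≤ ⟦ H ⟧) (gLowers s g)
  gLowers-sound s g k≤5q∸ k≤4q+B∸ = k≤5q∸ All.∷ k≤q+3B∸3 All.∷ k≤4q+B∸ All.∷ All.[]

  gUppers-sound : All (λ U → ⟦ U ⟧ ≤ suc k) gUppers
  gUppers-sound = ⟦B+1⟧≤1+k All.∷ subst (_≤ suc k) (sym ⟦q⟧) (subst (q k ≤_) (+-comm k 1) q≤k+1) All.∷ All.[]

  weight≤bound : ∀ n → 4 ≤ n → weight 8 n (f n) ≤ bound n k
  weight≤bound 4 _ = m+n≤o⇒m≤o∸n (weight 8 4 (f 4)) (begin
    weight 8 4 (f 4) + 6                ≡⟨ cong (_+ 6) (trans (weight≡W 4) (∑<-⟦⟧ 4 (λ t → ∑ₗ (map (gForm (gColumns 4 t)) (allFin 8))))) ⟩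
    ⟦ lin 16 16 0 40 ⟧ + 6             ≤⟨ m≤m+n (⟦ lin 16 16 0 40 ⟧ + 6) 2 ⟩
    ⟦ lin 16 16 0 40 ⟧ + 6 + 2         ≡⟨ eq x y k ⟩
    8 * 2 * (x + 2) + 16 * (y + 1)     ≡⟨ cong₂ (λ a b → 8 * 2 * a + 16 * b) q≡x+s B≡y+1 ⟨
    8 * 2 * q k + 16 * B k             ∎)
    where
    open ≤-Reasoning
    eq : ∀ x y k → 16 * x + 16 * y + 0 * k + 40 + 6 + 2 ≡ 8 * 2 * (x + 2) + 16 * (y + 1)
    eq = solve-∀
  weight≤bound 1 (s≤s ())
  weight≤bound 2 (s≤s (s≤s ()))
  weight≤bound 3 (s≤s (s≤s (s≤s ())))
  weight≤bound (suc (suc (suc (suc (suc p))))) _ = m+n≤o⇒m≤o∸n (weight 8 (5 + p) (f (5 + p))) (≤-reflexive (begin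
    weight 8 (5 + p) (f (5 + p)) + 2 * ((5 + p) ∸ (5 + p) / 3)  ≡⟨ cong (_+ 2 * ((5 + p) ∸ (5 + p) / 3)) (weight≡W (5 + p)) ⟩
    W (5 + p) + 2 * ((5 + p) ∸ (5 + p) / 3)                     ≡⟨ W+2[n∸n/3] p ⟩
    8 * (3 + p) * (x + 2) + 16 * (y + 1)                         ≡⟨ cong₂ (λ a b → 8 * (3 + p) * a + 16 * b) q≡x+s B≡y+1 ⟨
    8 * (3 + p) * q k + 16 * B k                                 ∎))
    where open ≡-Reasoning

  module _ (s g : ℕ) (k≤5q∸ : k ≤ ⟦ lin 5 0 0 s ⟧) (k≤4q+B∸ : k ≤ ⟦ lin 4 1 0 g ⟧) where
    open Certificate x y k 7 gForm (gLowers s g) gUppers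

    γ-byG : ∀ n → 4 ≤ n → (∀ t → t < n → T (columnsOK n (gColumns n) t)) → γ[ k ]R-CP≤ 8 n (bound n k)
    γ-byG n 4≤n ok =
      f n , columnsOK⇒isKRDF (gLowers-sound s g k≤5q∸ k≤4q+B∸) gUppers-sound n (gColumns n) ok , weight≤bound n 4≤n

  γ-n≥6 : ∀ n → 6 ≤ n → k ≤ ⟦ lin 4 1 0 3 ⟧ → γ[ k ]R-CP≤ 8 n (bound n k)
  γ-n≥6 n 6≤n k≤4q+B∸6 = γ-byG 5 3 k≤5q∸5 k≤4q+B∸6 n (≤-trans (m≤n+m 4 2) 6≤n) (GChecks.gColumns-OK x y k n 6≤n)

  γ-n=4 : 35 ≤ k → γ[ k ]R-CP≤ 8 4 (bound 4 k)
  γ-n=4 35≤k = γ-byG 5 2 k≤5q∸5 (k≤4q+B∸7 35≤k) 4 ≤-refl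
    (Certificate.all-columnsOK x y k 7 gForm (gLowers 5 2) gUppers 4 (gColumns 4) tt)

  γ-n=5 : 50 ≤ k → k + 6 ≤ 5 * q k → γ[ k ]R-CP≤ 8 5 (bound 5 k)
  γ-n=5 50≤k k+6≤5q = γ-byG 4 3 (k≤5q∸6 k+6≤5q) (k≤4q+B∸6 (≤-trans (m≤n+m 20 30) 50≤k)) 5 (m≤n+m 4 1)
    (Certificate.all-columnsOK x y k 7 gForm (gLowers 4 3) gUppers 5 (gColumns 5) tt)

-- The five-column design

-- At x = q k ∸ 3 the columns are B + 1, q − 2, q + 1, q − 2, B + 1.
uForm : ℕ → Column 8
uForm 1 _ = lin 1 0 0 1
uForm 2 _ = lin 1 0 0 4
uForm 3 _ = lin 1 0 0 1
uForm _ _ = [B+1]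

uLowers uUppers : List Lin
uLowers = lin 5 0 0 10 ∷ lin 1 3 0 3 ∷ lin 4 1 0 5 ∷ []
uUppers = [B+1] ∷ lin 1 0 0 4 ∷ []

module UDesign (k : ℕ) (1≤k : 1 ≤ k) (50≤k : 50 ≤ k) where
  open Parameters k 1≤k
  open Shifted k 1≤k 3 (3≤q (≤-trans (m≤m+n 6 44) 50≤k))
  open Certificate x y k 7 uForm uLowers uUppers

  uLowers-sound : All (λ H → k ≤ ⟦ H ⟧) uLowers
  uLowers-sound = lower-shift 5 0 0 10 5 (subst (k + 5 ≤_) (sym ⟦5q⟧) k+5≤5q)
    All.∷ k≤q+3B∸3
    All.∷ lower-shift 4 1 0 5 8 (subst (k + 8 ≤_) (sym ⟦4q+B⟧) (k+[4+c]≤4q+B 4 (+-monoˡ-≤ 10 50≤k)))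
    All.∷ All.[]

  uUppers-sound : All (λ U → ⟦ U ⟧ ≤ suc k) uUppers
  uUppers-sound = ⟦B+1⟧≤1+k All.∷ q+1≤1+k All.∷ All.[]
    where
    q+1≤1+k : ⟦ lin 1 0 0 4 ⟧ ≤ suc k
    q+1≤1+k = begin
      ⟦ lin 1 0 0 4 ⟧        ≡⟨ ⟦⟧-+const 1 0 0 3 1 ⟩
      ⟦ lin 1 0 0 3 ⟧ + 1    ≡⟨ cong (_+ 1) ⟦q⟧ ⟩
      q k + 1                ≤⟨ +-monoˡ-≤ 1 (q≤k (≤-trans (m≤m+n 3 47) 50≤k)) ⟩
      k + 1                  ≡⟨ +-comm k 1 ⟩
      suc k                  ∎
      where open ≤-Reasoning

  γ-n=5 : γ[ k ]R-CP≤ 8 5 (bound 5 k)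
  γ-n=5 = ByColumns.f x y k 7 5 uForm ,
          columnsOK⇒isKRDF uLowers-sound uUppers-sound 5 id (all-columnsOK 5 id tt) ,
          m+n≤o⇒m≤o∸n (weight 8 5 (ByColumns.f x y k 7 5 uForm)) (≤-reflexive (begin
            weight 8 5 (ByColumns.f x y k 7 5 uForm) + 8
              ≡⟨ cong (_+ 8) (trans (ByColumns.weight≡∑<-columns x y k 7 5 uForm) (∑<-⟦⟧ 5 (λ t → ∑ₗ (map (uForm t) (allFin 8))))) ⟩
            ⟦ lin 24 16 0 80 ⟧ + 8
              ≡⟨ eq x y k ⟩
            8 * 3 * (x + 3) + 16 * (y + 1)
              ≡⟨ cong₂ (λ a b → 8 * 3 * a + 16 * b) q≡x+s B≡y+1 ⟨
            8 * 3 * q k + 16 * B k ∎))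
    where
    open ≡-Reasoning
    eq : ∀ x y k → 24 * x + 16 * y + 0 * k + 80 + 8 ≡ 8 * 3 * (x + 3) + 16 * (y + 1)
    eq = solve-∀

-- Small n and k

tableForm : Vec ℕ 8 → Column 8
tableForm v i = lin 0 0 0 (Vec.lookup v i)

columnOf : List (Vec ℕ 8) → ℕ → Vec ℕ 8
columnOf []       t       = Vec.replicate 8 0
columnOf (v ∷ vs) zero    = v
columnOf (v ∷ vs) (suc t) = columnOf vs t

-- [k]-RDFs of C₈ □ P₅ for k = 20, 30, 35, where no other candidate meets the bound.
table₂₀ table₃₀ table₃₅ : List (Vec ℕ 8)
table₂₀ = ( 4 ∷  8 ∷  4 ∷ 10 ∷  0 ∷ 12 ∷  0 ∷ 10 ∷ [])
        ∷ ( 0 ∷  8 ∷  0 ∷  8 ∷  0 ∷  9 ∷  0 ∷  8 ∷ [])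
        ∷ ( 4 ∷  7 ∷  4 ∷  4 ∷  8 ∷  0 ∷  6 ∷  6 ∷ [])
        ∷ ( 8 ∷  0 ∷  9 ∷  0 ∷ 10 ∷  0 ∷ 10 ∷  0 ∷ [])
        ∷ (13 ∷  0 ∷ 12 ∷  0 ∷ 10 ∷  3 ∷  9 ∷  0 ∷ [])
        ∷ []
table₃₀ = (16 ∷ 13 ∷  4 ∷  3 ∷ 16 ∷ 13 ∷  3 ∷  3 ∷ [])
        ∷ ( 0 ∷  0 ∷ 13 ∷ 10 ∷  0 ∷  0 ∷ 14 ∷ 11 ∷ [])
        ∷ ( 9 ∷  7 ∷  6 ∷  8 ∷  9 ∷  6 ∷  8 ∷  5 ∷ [])
        ∷ (14 ∷ 11 ∷  0 ∷  0 ∷ 12 ∷ 11 ∷  0 ∷  1 ∷ [])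
        ∷ ( 5 ∷  0 ∷ 17 ∷ 14 ∷  0 ∷  7 ∷ 14 ∷ 13 ∷ [])
        ∷ []
table₃₅ = (16 ∷  5 ∷  0 ∷ 19 ∷ 17 ∷  3 ∷  6 ∷ 16 ∷ [])
        ∷ ( 0 ∷ 16 ∷ 14 ∷  0 ∷  0 ∷ 12 ∷ 13 ∷  0 ∷ [])
        ∷ ( 6 ∷ 10 ∷  7 ∷  7 ∷  9 ∷ 10 ∷  7 ∷  9 ∷ [])
        ∷ (13 ∷  0 ∷  0 ∷ 18 ∷ 12 ∷  0 ∷  0 ∷ 16 ∷ [])
        ∷ ( 6 ∷ 18 ∷ 13 ∷  6 ∷  0 ∷ 20 ∷ 16 ∷  0 ∷ [])
        ∷ []

record Layout : Set₁ where
  constructor layout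
  field
    {Col}   : Set
    form    : Col → Column 8
    x y     : ℕ
    columns : ℕ → Col

certifies : ℕ → ℕ → Layout → Bool
certifies n k (layout form x y columns) = Certificate.certified x y k 7 form [] [] n columns (bound n k)

certifies-sound : ∀ n k L → T (certifies n k L) → γ[ k ]R-CP≤ 8 n (bound n k)
certifies-sound n k (layout form x y columns) =
  Certificate.certified-sound x y k 7 form [] [] All.[] All.[] n columns (bound n k)

candidates : ℕ → ℕ → List Layout
candidates n k = layout staggeredForm 0 0 even
               ∷ layout gForm (q k ∸ 2) (B k ∸ 1) (gColumns n)
               ∷ layout uForm (q k ∸ 3) (B k ∸ 1) id
               ∷ layout tableForm 0 0 (columnOf table₂₀)
               ∷ layout tableForm 0 0 (columnOf table₃₀)
               ∷ layout tableForm 0 0 (columnOf table₃₅)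
               ∷ []

γ-certified : ∀ n K → T (all (λ k → any (certifies n k) (candidates n k)) (applyUpTo suc K)) →
  ∀ k → 1 ≤ k → k ≤ K → γ[ k ]R-CP≤ 8 n (bound n k)
γ-certified n K ok (suc k) _ k<K =
  let L , _ , certified = find (any⁻ (certifies n (suc k)) (candidates n (suc k)) for-k)
  in certifies-sound n (suc k) L certified
  where
  for-k : T (any (certifies n (suc k)) (candidates n (suc k)))
  for-k = All.lookup (all⁺ (λ k → any (certifies n k) (candidates n k)) (applyUpTo suc K) ok) (∈-applyUpTo⁺ suc k<K)

γ-n=4 : ∀ k → 1 ≤ k → γ[ k ]R-CP≤ 8 4 (bound 4 k)
γ-n=4 k 1≤k with k ≤? 34
... | yes k≤34 = γ-certified 4 34 tt k 1≤k k≤34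
... | no  k≰34 = GDesign.γ-n=4 k 1≤k (≰⇒> k≰34)

γ-n=5 : ∀ k → 1 ≤ k → γ[ k ]R-CP≤ 8 5 (bound 5 k)
γ-n=5 k 1≤k with k ≤? 49 | k + 6 ≤? 5 * q k
... | yes k≤49 | _         = γ-certified 5 49 tt k 1≤k k≤49
... | no  k≰49 | yes k+6≤5q = GDesign.γ-n=5 k 1≤k (≰⇒> k≰49) k+6≤5q
... | no  k≰49 | no  _      = UDesign.γ-n=5 k 1≤k (≰⇒> k≰49)

4q+B∸6 : ℕ → ℕ
4q+B∸6 k = Evaluation.⟦_⟧ (q k ∸ 2) (B k ∸ 1) k (lin 4 1 0 3)

k≤4q+B∸6-below20 : T (all (λ k → (k ≡ᵇ 5) ∨ (k ≤ᵇ 4q+B∸6 k)) (applyUpTo suc 19))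
k≤4q+B∸6-below20 = tt

k≤4q+B∸6 : ∀ k → 1 ≤ k → k ≢ 5 → k ≤ 4q+B∸6 k
k≤4q+B∸6 k 1≤k k≢5 with k <? 20
... | no  k≮20 = GDesign.k≤4q+B∸6 k 1≤k (≮⇒≥ k≮20)
... | yes k<20 = below20 k k<20 k≢5
  where
  below20 : ∀ k → k < 20 → k ≢ 5 → k ≤ 4q+B∸6 k
  below20 zero    _          _   = z≤n
  below20 (suc k) (s≤s k<19) k≢5
    with Equivalence.to T-∨ (All.lookup (all⁺ (λ k → (k ≡ᵇ 5) ∨ (k ≤ᵇ 4q+B∸6 k)) (applyUpTo suc 19) k≤4q+B∸6-below20)
                                        (∈-applyUpTo⁺ suc k<19))
  ... | inj₁ k≡5 = ⊥-elim (k≢5 (≡ᵇ⇒≡ (suc k) 5 k≡5))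
  ... | inj₂ k≤  = ≤ᵇ⇒≤ (suc k) (4q+B∸6 (suc k)) k≤

γ-n≥6 : ∀ n k → 6 ≤ n → 1 ≤ k → k ≢ 5 → γ[ k ]R-CP≤ 8 n (bound n k)
γ-n≥6 n k 6≤n 1≤k k≢5 = GDesign.γ-n≥6 k 1≤k n 6≤n (k≤4q+B∸6 k 1≤k k≢5)

γ-k≢5 : ∀ n k → 4 ≤ n → 1 ≤ k → k ≢ 5 → γ[ k ]R-CP≤ 8 n (bound n k)
γ-k≢5 4 k _ 1≤k _ = γ-n=4 k 1≤k
γ-k≢5 5 k _ 1≤k _ = γ-n=5 k 1≤k
γ-k≢5 (suc (suc (suc (suc (suc (suc n)))))) k _ 1≤k k≢5 = γ-n≥6 (6 + n) k (m≤m+n 6 n) 1≤k k≢5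
γ-k≢5 1 k (s≤s ()) _ _
γ-k≢5 2 k (s≤s (s≤s ())) _ _
γ-k≢5 3 k (s≤s (s≤s (s≤s ()))) _ _

theorem22 : (n k : ℕ) → 4 ≤ n → 1 ≤ k →
    γ[ k ]R-CP≤ 8 n
      ((8 * (n ∸ 2) * ⌈ k + 5 /suc 4 ⌉
        + 16 * ⌈ (k + 3) ∸ ⌈ k + 5 /suc 4 ⌉ /suc 2 ⌉)
       ∸ 2 * (n ∸ (n / 3)))
theorem22 n k 4≤n 1≤k with k ≟ 5
... | yes refl = γ-k=5 n (≤-trans (m≤m+n 2 2) 4≤n)
... | no  k≢5  = γ-k≢5 n k 4≤n 1≤k k≢5
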